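{- Let $G$ be a graph, let $\ell\geq 1$, and let $L=L_1\cup L_2\cup L_3$ be a set of $k\geq \ell$ leaks, where $L_1$ is the set of vertex leaks, $L_2$ the set of edge leaks and $L_3$ the set of specified leaks in $L$. If $B\subseteq V(G)$ is a mixed $(\ell-1)$-leaky forcing set of $G$, then \[|L_1\setminus B^{[\infty]}_L|+ |L_2- B^{[\infty]}_L| + |L_3- B^{[\infty]}_L| \leq k-\ell.\]
   Context: All graphs are finite simple graphs. Given a graph $G$ and a set $B\subseteq V(G)$ of initially blue vertices (all other vertices white), the zero forcing color-change rule says: if a blue vertex $u$ has exactly one white neighbor $w$, then $u$ may force $w$ (written $u\rightarrow w$). A vertex leak is a vertex not allowed to perform any force. An edge leak is an edge $xy$ across which no force may be performed (neither $x\rightarrow y$ nor $y\rightarrow x$). A specified leak $x\rightarrow y$ (for adjacent $x,y$) prohibits the single force of $x$ forcing $y$; $x$ is its tail. These are collectively called leaks. A set $B$ is a mixed $\ell$-leaky forcing set of $G$ if $B$ can color all of $G$ blue despite any set of $\ell$ leaks (each being a vertex leak, edge leak or specified leak). For a set $L$ of leaks, $B^{[\infty]}_L$ is the set of blue vertices obtained from $B$ after exhaustively applying the color-change rule subject to all leaks in $L$. For $S\subseteq V(G)$: for a set $L_2$ of edge leaks, $L_2-S=\{xy\in L_2: x\notin S,\ y\notin S\}$; for a set $L_3$ of specified leaks, $L_3-S=\{x\rightarrow y\in L_3: x\notin S\}$. -}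

module Defs where

open import Data.Nat using (ℕ; _≤_; _<_; suc)
open import Data.Fin using (Fin; toℕ)
open import Data.Bool using (Bool; true; false; not; _∧_; _∨_)
open import Data.List using (List; length; filter; []; _∷_)
open import Data.List.Relation.Unary.All using (All)
open import Data.List.Relation.Unary.Unique.Propositional using (Unique)
open import Data.Product using (_×_; ∃)
open import Data.Empty using (⊥)
open import Data.Unit using (⊤)
open import Relation.Nullary using (¬_)
open import Relation.Binary.PropositionalEquality using (_≡_; _≢_)
open import Data.Fin using (_≟_)
open import Relation.Nullary.Decidable using (does)
open import Relation.Unary using (Pred)
open import Level using (0ℓ)

record Graph (n : ℕ) : Set where
  field
    adj    : Fin n → Fin n → Bool
    sym    : ∀ x y → adj x y ≡ adj y x
    irrefl : ∀ x → adj x x ≡ false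
open Graph public

VSet : ℕ → Set
VSet n = Fin n → Bool

_∈ₛ_ : ∀ {n} → Fin n → VSet n → Set
v ∈ₛ S = S v ≡ true

insert : ∀ {n} → Fin n → VSet n → VSet n
insert w S v = does (v ≟ w) ∨ S v

-- Leaks.  An edge leak on the edge {x,y} is represented uniquely as
-- edgeLeak x y with toℕ x < toℕ y.  specLeak x y is the specified leak x → y.
data Leak (n : ℕ) : Set where
  vertexLeak : Fin n → Leak n
  edgeLeak   : Fin n → Fin n → Leak n
  specLeak   : Fin n → Fin n → Leak n

WFLeak : ∀ {n} → Graph n → Leak n → Set
WFLeak G (vertexLeak v) = ⊤
WFLeak G (edgeLeak x y) = (adj G x y ≡ true) × (toℕ x < toℕ y)
WFLeak G (specLeak x y) = adj G x y ≡ true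

-- A set of leaks of G: a duplicate-free list of legitimate leaks.
-- Its cardinality is its length.
record LeakSet {n : ℕ} (G : Graph n) : Set where
  field
    leaks  : List (Leak n)
    unique : Unique leaks
    wf     : All (WFLeak G) leaks
open LeakSet public

data Blocks {n : ℕ} (u w : Fin n) : Leak n → Set where
  byVertex : Blocks u w (vertexLeak u)
  byEdge₁  : Blocks u w (edgeLeak u w)
  byEdge₂  : Blocks u w (edgeLeak w u)
  bySpec   : Blocks u w (specLeak u w)

record ValidForce {n : ℕ} (G : Graph n) (L : LeakSet G) (S : VSet n) (u w : Fin n) : Set where
  field
    uBlue     : u ∈ₛ S
    wWhite    : S w ≡ false
    adjacent  : adj G u w ≡ true
    onlyWhite : ∀ x → adj G u x ≡ true → x ≢ w → x ∈ₛ S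
    notLeaked : All (λ λ' → ¬ Blocks u w λ') (leaks L)

data Reach {n : ℕ} (G : Graph n) (L : LeakSet G) (B : VSet n) : VSet n → Set where
  start : Reach G L B B
  force : ∀ {S} u w → Reach G L B S → ValidForce G L S u w → Reach G L B (insert w S)

Final : ∀ {n} (G : Graph n) (L : LeakSet G) (B S : VSet n) → Set
Final G L B S = Reach G L B S × (∀ u w → ¬ ValidForce G L S u w)

Colors : ∀ {n} (G : Graph n) (L : LeakSet G) (B : VSet n) → Set
Colors {n} G L B = Reach G L B (λ _ → true)

MixedLeakyForcing : ∀ {n} (G : Graph n) (ℓ : ℕ) (B : VSet n) → Set
MixedLeakyForcing G ℓ B = ∀ (L : LeakSet G) → length (leaks L) ≤ ℓ → Colors G L B

vertexOutside : ∀ {n} → VSet n → Leak n → Bool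
vertexOutside S (vertexLeak v) = not (S v)
vertexOutside S _ = false

edgeOutside : ∀ {n} → VSet n → Leak n → Bool
edgeOutside S (edgeLeak x y) = not (S x) ∧ not (S y)
edgeOutside S _ = false

specOutside : ∀ {n} → VSet n → Leak n → Bool
specOutside S (specLeak x y) = not (S x)
specOutside S _ = false

count : ∀ {A : Set} → (A → Bool) → List A → ℕ
count p [] = 0
count p (x ∷ xs) with p x
... | true  = suc (count p xs)
... | false = count p xs

{-# OPTIONS --safe #-}
module Submission where

-- Call a leak outside S when it lies in L₁ ∖ S, L₂ − S or L₃ − S, and
-- touching S otherwise.  No leak outside S = B^[∞]_L can block a force from
-- the blue vertex set S, so S is already stalled under the touching leaks
-- alone, and then no forcing process from B under those leaks ever leaves S.
-- If there are at most ℓ − 1 touching leaks, the (ℓ − 1)-leaky forcing set B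
-- colours all of G under them, so S = V(G) and nothing is outside S.
-- Otherwise at least ℓ of the k leaks touch S, so at most k − ℓ are outside.

open import Defs hiding (sym)
open import Function using (_∘_)
open import Data.Nat using (ℕ; zero; suc; _≤_; _+_; _∸_; z≤n; _≤?_)
open import Data.Nat.Properties using (+-suc; ≰⇒>; m+n∸m≡n; ∸-monoʳ-≤)
open import Data.Bool using (Bool; true; false; not; _∧_; T)
open import Data.Fin using (Fin; _≟_)
open import Data.List using ([]; _∷_; length; filter)
open import Data.List.Relation.Unary.All as All using (All)
open import Data.List.Relation.Unary.All.Properties using (all-filter; filter⁺; filter⁻)
import Data.List.Relation.Unary.Unique.Propositional.Properties as Unique
open import Data.Product using (_,_)
open import Data.Empty using (⊥-elim)
open import Relation.Nullary using (¬_; yes; no)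
open import Relation.Nullary.Decidable using (does; T?; ¬?)
open import Relation.Binary.PropositionalEquality using (_≡_; refl; sym; trans; cong; subst; module ≡-Reasoning)

count-none : ∀ {A : Set} (p : A → Bool) → (∀ x → p x ≡ false) → ∀ xs → count p xs ≡ 0
count-none p none [] = refl
count-none p none (x ∷ xs) with p x | none x
... | false | _ = count-none p none xs

length-reject+count : ∀ {A : Set} (p : A → Bool) xs →
  length (filter (¬? ∘ T? ∘ p) xs) + count p xs ≡ length xs
length-reject+count p [] = refl
length-reject+count p (x ∷ xs) with p x
... | true  = trans (+-suc _ _) (cong suc (length-reject+count p xs))
... | false = cong suc (length-reject+count p xs)

module _ {n : ℕ} (S : VSet n) where

  outside : Leak n → Bool
  outside (vertexLeak v) = not (S v)
  outside (edgeLeak x y) = not (S x) ∧ not (S y)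
  outside (specLeak x y) = not (S x)

  count-outside : ∀ xs → count outside xs
    ≡ count (vertexOutside S) xs + count (edgeOutside S) xs + count (specOutside S) xs
  count-outside [] = refl
  count-outside (vertexLeak v ∷ xs) with not (S v)
  ... | true  = cong suc (count-outside xs)
  ... | false = count-outside xs
  count-outside (edgeLeak x y ∷ xs) with not (S x) ∧ not (S y)
  ... | true  = trans (cong suc (count-outside xs))
                      (cong (_+ count (specOutside S) xs) (sym (+-suc _ _)))
  ... | false = count-outside xs
  count-outside (specLeak x y ∷ xs) with not (S x)
  ... | true  = trans (cong suc (count-outside xs)) (sym (+-suc _ _))
  ... | false = count-outside xs

  blocks⇒¬outside : ∀ {u w λ'} → u ∈ₛ S → Blocks u w λ' → ¬ T (outside λ')
  blocks⇒¬outside u∈S byVertex rewrite u∈S = λ ()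
  blocks⇒¬outside u∈S byEdge₁  rewrite u∈S = λ ()
  blocks⇒¬outside {w = w} u∈S byEdge₂ rewrite u∈S with S w
  ... | true  = λ ()
  ... | false = λ ()
  blocks⇒¬outside u∈S bySpec   rewrite u∈S = λ ()

  outside-full : (∀ v → v ∈ₛ S) → ∀ λ' → outside λ' ≡ false
  outside-full full (vertexLeak v) rewrite full v = refl
  outside-full full (edgeLeak x y) rewrite full x = refl
  outside-full full (specLeak x y) rewrite full x = refl

touching : ∀ {n} {G : Graph n} → LeakSet G → VSet n → LeakSet G
touching L S = record
  { leaks  = filter (¬? ∘ T? ∘ outside S) (leaks L)
  ; unique = Unique.filter⁺ (¬? ∘ T? ∘ outside S) (unique L)
  ; wf     = filter⁺ (¬? ∘ T? ∘ outside S) (wf L)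
  }

_⊆ₛ_ : ∀ {n} → VSet n → VSet n → Set
S ⊆ₛ T = ∀ v → v ∈ₛ S → v ∈ₛ T

insert-⊇ : ∀ {n} (w : Fin n) (S : VSet n) → S ⊆ₛ insert w S
insert-⊇ w S v v∈S with does (v ≟ w)
... | true  = refl
... | false = v∈S

module _ {n : ℕ} {G : Graph n} where

  Stalled : LeakSet G → VSet n → Set
  Stalled L S = ∀ u w → ¬ ValidForce G L S u w

  Reach-⊇ : ∀ {L B S} → Reach G L B S → B ⊆ₛ S
  Reach-⊇ start               v v∈B = v∈B
  Reach-⊇ (force {S} u w r _) v v∈B = insert-⊇ w S v (Reach-⊇ r v v∈B)

  ValidForce-leaks : ∀ {L L′ S u w} → ValidForce G L S u w →
    All (λ λ' → ¬ Blocks u w λ') (leaks L′) → ValidForce G L′ S u w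
  ValidForce-leaks f unblocked = record
    { uBlue = uBlue ; wWhite = wWhite ; adjacent = adjacent
    ; onlyWhite = onlyWhite ; notLeaked = unblocked }
    where open ValidForce f

  ValidForce-⊆ : ∀ {L T S u w} → T ⊆ₛ S → S w ≡ false →
    ValidForce G L T u w → ValidForce G L S u w
  ValidForce-⊆ T⊆S w∉S f = record
    { uBlue = T⊆S _ uBlue ; wWhite = w∉S ; adjacent = adjacent
    ; onlyWhite = λ x ux x≢w → T⊆S x (onlyWhite x ux x≢w) ; notLeaked = notLeaked }
    where open ValidForce f

  Stalled-touching : ∀ {L S} → Stalled L S → Stalled (touching L S) S
  Stalled-touching {L} {S} stuck u w f = stuck u w (ValidForce-leaks f
    (filter⁻ (T? ∘ outside S)
      (All.map (λ out b → blocks⇒¬outside S (ValidForce.uBlue f) b out)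
               (all-filter (T? ∘ outside S) (leaks L)))
      (ValidForce.notLeaked f)))

  Reach-⊆-Stalled : ∀ {L B S T} → Stalled L S → B ⊆ₛ S → Reach G L B T → T ⊆ₛ S
  Reach-⊆-Stalled stuck B⊆S start = B⊆S
  Reach-⊆-Stalled {S = S} stuck B⊆S (force {T} u w r f) v v∈T′ with v ≟ w
  ... | no _     = Reach-⊆-Stalled stuck B⊆S r v v∈T′
  ... | yes refl with S v in w∉S
  ...   | true  = refl
  ...   | false = ⊥-elim (stuck u w (ValidForce-⊆ (Reach-⊆-Stalled stuck B⊆S r) w∉S f))

lemma4p1 : ∀ {n} (G : Graph n) (ℓ : ℕ) (L : LeakSet G) (B S : VSet n) →
    1 ≤ ℓ → ℓ ≤ length (leaks L) →
    MixedLeakyForcing G (ℓ ∸ 1) B →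
    Final G L B S →
    count (vertexOutside S) (leaks L) + count (edgeOutside S) (leaks L) + count (specOutside S) (leaks L)
      ≤ length (leaks L) ∸ ℓ
lemma4p1 G zero L B S () _ _ _
lemma4p1 G (suc ℓ) L B S _ _ leaky (reach , stuck)
  rewrite sym (count-outside S (leaks L))
  with length (leaks (touching L S)) ≤? ℓ
... | yes few = subst (_≤ _) (sym (count-none (outside S) (outside-full S full) (leaks L))) z≤n
  where
  full : ∀ v → v ∈ₛ S
  full v = Reach-⊆-Stalled (Stalled-touching stuck) (Reach-⊇ reach) (leaky (touching L S) few) v refl
... | no many = subst (_≤ k ∸ suc ℓ) (sym outside≡) (∸-monoʳ-≤ k (≰⇒> many))
  where
  k m c : ℕ
  k = length (leaks L)
  m = length (leaks (touching L S))
  c = count (outside S) (leaks L)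
  outside≡ : c ≡ k ∸ m
  outside≡ = begin
    c          ≡⟨ m+n∸m≡n m c ⟨
    m + c ∸ m  ≡⟨ cong (_∸ m) (length-reject+count (outside S) (leaks L)) ⟩
    k ∸ m      ∎
    where open ≡-Reasoning
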